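{- Let $(L;\leq,\oplus,',0,1)$ be a weak lattice effect algebra. Then the following are equivalent: (RD1) $(L;\oplus,0,1)$ is a lattice effect algebra in which $a'$ is the orthosupplement of $a$ for each $a\in L$; (RD2) for all $a,b,x\in L$: $a\otimes x\leq b$ if and only if $x\leq a\rightarrow_s b$; (RD3) for all $a,b,x\in L$: $b'\leq a'\oplus(a\wedge x')$ if and only if $x\leq a'\oplus(a\wedge b)$; (RD4) for all $a,b\in L$: $a\leq b$ if and only if $a\rightarrow_s b=1$; (RD5) for all $a,b\in L$: $a\oplus b=1$ if and only if $b=a'$; (RD6) for all $a,b,c\in L$: if $a\oplus b=c$ then $a\oplus c'=b'$; (RD7) for all $a,b\in L$: if $a\leq b$ then $a\oplus(a'\odot b)=b$; (RD8) for all $a,b\in L$: $a\leq b$ if and only if there is a unique $c\in L$ such that $a\oplus c=b$.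
   Context: A bounded involutive lattice is a structure $(L;\leq,',0,1)$ where $(L;\leq,0,1)$ is a bounded lattice (meet $\wedge$, join $\vee$) and $'$ is a unary operation with $a''=a$ and $a\leq b\Rightarrow b'\leq a'$. A weak lattice effect algebra is a bounded involutive lattice $(L;\leq,\oplus,',0,1)$ with a partial binary operation $\oplus$ such that $a\oplus b$ is defined if and only if $a\leq b'$, and: (W1) if $a\oplus b$ is defined then $a\oplus b=b\oplus a$; (W2) if $b\oplus c$ and $a\oplus(b\oplus c)$ are defined then $a\oplus b$ and $(a\oplus b)\oplus c$ are defined and $a\oplus(b\oplus c)=(a\oplus b)\oplus c$; (W3) $a\oplus 0=a$. In a weak lattice effect algebra define the total operations $a\otimes b:=(a'\oplus(a\wedge b'))'$ (Sasaki product) and $a\rightarrow_s b:=a'\oplus(a\wedge b)$ (Sasaki arrow), and the partial operation $a\odot b:=(a'\oplus b')'$ (defined iff $a'\leq b$). An effect algebra is a structure $(E;\oplus,0,1)$ with $\oplus$ a partial binary operation such that for all $a,b,c\in E$: (E1) if $a\oplus b$ is defined then $b\oplus a$ is defined and $a\oplus b=b\oplus a$; (E2) if $b\oplus c$ and $a\oplus(b\oplus c)$ are defined then $a\oplus b$ and $(a\oplus b)\oplus c$ are defined and $a\oplus(b\oplus c)=(a\oplus b)\oplus c$; (E3) for every $a$ there is a unique $a'$ (the orthosupplement) with $a\oplus a'$ defined and $a\oplus a'=1$; (E4) if $a\oplus 1$ is defined then $a=0$. The relation $a\leq b$ iff $a\oplus c=b$ for some $c$ is a partial order; a lattice effect algebra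 is an effect algebra for which this order is a lattice. -}

module Defs where

open import Data.Product using (Σ; Σ-syntax; ∃; ∃-syntax; ∃!; _×_; _,_)
open import Relation.Binary.PropositionalEquality using (_≡_; subst; sym)
open import Relation.Binary.Lattice.Structures using (IsBoundedLattice)
open import Function.Bundles using (_⇔_)

-- The partial operation ⊕ is modelled as a function taking an
-- (irrelevant) proof of its definedness condition  a ≤ b ′ .

record WeakLatticeEffectAlgebra : Set₁ where
  infixr 7 _∧_
  infixr 6 _∨_
  infix  4 _≤_
  infix  9 _′
  field
    Carrier : Set
    _≤_     : Carrier → Carrier → Set
    _∨_     : Carrier → Carrier → Carrier
    _∧_     : Carrier → Carrier → Carrier
    _′      : Carrier → Carrier
    𝟘       : Carrier
    𝟙       : Carrier
    isBoundedLattice : IsBoundedLattice _≡_ _≤_ _∨_ _∧_ 𝟙 𝟘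
    ′-involutive : ∀ a → (a ′) ′ ≡ a
    ′-antitone   : ∀ {a b} → a ≤ b → b ′ ≤ a ′
    plus : (a b : Carrier) → .(a ≤ b ′) → Carrier
    W1 : ∀ a b (p : a ≤ b ′) (q : b ≤ a ′) → plus a b p ≡ plus b a q
    W2 : ∀ a b c (p : b ≤ c ′) (q : a ≤ (plus b c p) ′) →
         Σ[ r ∈ a ≤ b ′ ] Σ[ s ∈ plus a b r ≤ c ′ ]
           (plus a (plus b c p) q ≡ plus (plus a b r) c s)
    W3 : ∀ a (p : a ≤ 𝟘 ′) → plus a 𝟘 p ≡ a

  open IsBoundedLattice isBoundedLattice public

  Def : Carrier → Carrier → Set
  Def a b = a ≤ b ′

  _⊕_≐_ : Carrier → Carrier → Carrier → Set
  a ⊕ b ≐ c = Σ[ d ∈ Def a b ] (plus a b d ≡ c)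

  ∧-def : ∀ a b → Def (a ′) (a ∧ b)
  ∧-def a b = ′-antitone (x∧y≤x a b)

  _⊗_ : Carrier → Carrier → Carrier
  a ⊗ b = (plus (a ′) (a ∧ b ′) (∧-def a (b ′))) ′

  _→s_ : Carrier → Carrier → Carrier
  a →s b = plus (a ′) (a ∧ b) (∧-def a b)

  odot : (a b : Carrier) → .(a ′ ≤ b) → Carrier
  odot a b p = (plus (a ′) (b ′) (subst (λ z → a ′ ≤ z) (sym (′-involutive b)) p)) ′

  odot-def : ∀ {a b} → a ≤ b → (a ′) ′ ≤ b
  odot-def {a} {b} p = subst (λ z → z ≤ b) (sym (′-involutive a)) p

  _≤⊕_ : Carrier → Carrier → Set
  a ≤⊕ b = ∃[ c ] (a ⊕ c ≐ b)

  record IsEffectAlgebra : Set where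
    field
      E1 : ∀ a b (d : Def a b) → Σ[ e ∈ Def b a ] (plus a b d ≡ plus b a e)
      E2 : ∀ a b c (p : Def b c) (q : Def a (plus b c p)) →
           Σ[ r ∈ Def a b ] Σ[ s ∈ Def (plus a b r) c ]
             (plus a (plus b c p) q ≡ plus (plus a b r) c s)
      E3 : ∀ a → ∃! _≡_ (λ b → a ⊕ b ≐ 𝟙)
      E4 : ∀ a → Def a 𝟙 → a ≡ 𝟘

  IsLatticeOrder : Set
  IsLatticeOrder =
    (∀ a b → ∃[ s ] (a ≤⊕ s × b ≤⊕ s × (∀ z → a ≤⊕ z → b ≤⊕ z → s ≤⊕ z))) ×
    (∀ a b → ∃[ i ] (i ≤⊕ a × i ≤⊕ b × (∀ z → z ≤⊕ a → z ≤⊕ b → z ≤⊕ i)))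

  RD1 : Set
  RD1 = IsEffectAlgebra × IsLatticeOrder × (∀ a → a ⊕ (a ′) ≐ 𝟙)

  RD2 : Set
  RD2 = ∀ a b x → ((a ⊗ x) ≤ b) ⇔ (x ≤ (a →s b))

  RD3 : Set
  RD3 = ∀ a b x → (b ′ ≤ plus (a ′) (a ∧ x ′) (∧-def a (x ′)))
                ⇔ (x ≤ plus (a ′) (a ∧ b) (∧-def a b))

  RD4 : Set
  RD4 = ∀ a b → (a ≤ b) ⇔ ((a →s b) ≡ 𝟙)

  RD5 : Set
  RD5 = ∀ a b → (a ⊕ b ≐ 𝟙) ⇔ (b ≡ a ′)

  RD6 : Set
  RD6 = ∀ a b c → a ⊕ b ≐ c → a ⊕ (c ′) ≐ (b ′)

  RD7 : Set
  RD7 = ∀ a b (p : a ≤ b) → a ⊕ odot (a ′) b (odot-def p) ≐ b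

  RD8 : Set
  RD8 = ∀ a b → (a ≤ b) ⇔ ∃! _≡_ (λ c → a ⊕ c ≐ b)

module Submission where

open import Defs
open import Data.Product using (_×_)
open import Function.Bundles using (_⇔_)
open WeakLatticeEffectAlgebra using (RD1; RD2; RD3; RD4; RD5; RD6; RD7; RD8)

open import Data.Product using (Σ-syntax; _,_; proj₁)
open import Function.Base using (_∘_)
open import Function.Bundles using (mk⇔; Equivalence)
open import Relation.Binary.PropositionalEquality as ≡ using (_≡_; cong; subst)

-- Since the definedness proof is an irrelevant
-- argument of plus, ⊕ is functional, and (W1), (W2) become commutativity
-- and (two-sided) associativity of ≐.
-- The hub of the argument is (RD6).  In its presence ≤ coincides with the
-- order induced by ⊕ (every a ≤ b has a difference c with a ⊕ c = b, and
-- every summand lies below the sum), ⊕ is monotone and cancellative; this yields (RD1) and,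
-- via a Galois-connection argument, (RD3).  The equivalences are then
--   RD1 ⇔ RD5 ⇔ RD6   and   RD6 ⇒ RD3 ⇒ RD2 ⇒ RD4 ⇒ RD5,
--   RD6 ⇒ RD7 ⇒ RD5,  RD6 ⇒ RD8 ⇒ RD5,
-- each direction "⇒ RD5" being a computation showing that a ⊕ b = 1
-- forces b = a′.

sandwich : {A P Q X : Set} → A ⇔ P → A ⇔ Q → (P → X) → (X → Q) → A ⇔ X
sandwich A⇔P A⇔Q P⇒X X⇒Q =
  mk⇔ (P⇒X ∘ Equivalence.to A⇔P) (Equivalence.from A⇔Q ∘ X⇒Q)

module Conditions (L : WeakLatticeEffectAlgebra) where
  open WeakLatticeEffectAlgebra L
    hiding (RD1; RD2; RD3; RD4; RD5; RD6; RD7; RD8)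
    renaming (refl to ≤-refl; trans to ≤-trans)
  open Equivalence using (to; from)

  ′′ : ∀ a → a ′ ′ ≡ a
  ′′ = ′-involutive

  ′-shift : ∀ {a b} → b ′ ≡ a → b ≡ a ′
  ′-shift {a} {b} e = ≡.trans (≡.sym (′′ b)) (cong _′ e)

  ′-injective : ∀ {a b} → a ′ ≡ b ′ → a ≡ b
  ′-injective {a} {b} e = ≡.trans (′-shift e) (′′ b)

  def-sym : ∀ {a b} → Def a b → Def b a
  def-sym {a} {b} p = subst (λ z → z ≤ a ′) (′′ b) (′-antitone p)

  ′-swap : ∀ {u v} → u ′ ≤ v → v ′ ≤ u
  ′-swap {u} {v} p = subst (v ′ ≤_) (′′ u) (′-antitone p)

  ≤-′′ : ∀ {a b} → a ≤ b → Def a (b ′)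
  ≤-′′ {a} {b} p = subst (a ≤_) (≡.sym (′′ b)) p

  𝟙′≡𝟘 : 𝟙 ′ ≡ 𝟘
  𝟙′≡𝟘 = antisym (′-swap (maximum (𝟘 ′))) (minimum _)

  𝟘′≡𝟙 : 𝟘 ′ ≡ 𝟙
  𝟘′≡𝟙 = ≡.sym (′-shift 𝟙′≡𝟘)

  def-𝟘 : ∀ a → Def a 𝟘
  def-𝟘 a = subst (a ≤_) (≡.sym 𝟘′≡𝟙) (maximum a)

  def-𝟙 : ∀ {a} → Def a 𝟙 → a ≡ 𝟘
  def-𝟙 {a} p = antisym (subst (a ≤_) 𝟙′≡𝟘 p) (minimum a)

  ∧-below : ∀ {a b} → b ≤ a → a ∧ b ≡ b
  ∧-below h = antisym (x∧y≤y _ _) (∧-greatest h ≤-refl)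

  plus-cong : ∀ {x x′ y y′} → x ≡ x′ → y ≡ y′ →
              (p : Def x y) (q : Def x′ y′) → plus x y p ≡ plus x′ y′ q
  plus-cong ≡.refl ≡.refl p q = ≡.refl

  ≐-resp : ∀ {x x′ y y′ z z′} → x ≡ x′ → y ≡ y′ → z ≡ z′ →
           x ⊕ y ≐ z → x′ ⊕ y′ ≐ z′
  ≐-resp ≡.refl ≡.refl ≡.refl h = h

  ⊕-functional : ∀ {a b z z′} → a ⊕ b ≐ z → a ⊕ b ≐ z′ → z ≡ z′
  ⊕-functional (_ , e) (_ , e′) = ≡.trans (≡.sym e) e′

  ⊕-unit : ∀ a → a ⊕ 𝟘 ≐ a
  ⊕-unit a = def-𝟘 a , W3 a (def-𝟘 a)

  ⊕-comm : ∀ {a b z} → a ⊕ b ≐ z → b ⊕ a ≐ z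
  ⊕-comm {a} {b} (d , e) = def-sym d , ≡.trans (≡.sym (W1 a b d (def-sym d))) e

  ⊕-assocˡ : ∀ {a b c bc z} → b ⊕ c ≐ bc → a ⊕ bc ≐ z →
             Σ[ ab ∈ Carrier ] (a ⊕ b ≐ ab × ab ⊕ c ≐ z)
  ⊕-assocˡ {a} {b} {c} (p , ≡.refl) (q , ≡.refl) with W2 a b c p q
  ... | r , s , eq = plus a b r , (r , ≡.refl) , (s , ≡.sym eq)

  ⊕-assocʳ : ∀ {a b c ab z} → a ⊕ b ≐ ab → ab ⊕ c ≐ z →
             Σ[ bc ∈ Carrier ] (b ⊕ c ≐ bc × a ⊕ bc ≐ z)
  ⊕-assocʳ hab habc with ⊕-assocˡ (⊕-comm hab) (⊕-comm habc)
  ... | cb , hcb , hcba = cb , ⊕-comm hcb , ⊕-comm hcba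

  module UnderRD6 (rd6 : RD6 L) where

    ⊕-upper : ∀ {a d z} → a ⊕ d ≐ z → a ≤ z
    ⊕-upper {a} {d} {z} h = subst (a ≤_) (′′ z) (proj₁ (rd6 a d z h))

    difference : ∀ {a b} → a ≤ b → Σ[ c ∈ Carrier ] (a ⊕ c ≐ b)
    difference {a} {b} a≤b =
      _ , ≐-resp ≡.refl ≡.refl (′′ b) (rd6 a (b ′) _ (≤-′′ a≤b , ≡.refl))

    ≤⊕⇔≤ : ∀ {a b} → (a ≤⊕ b) ⇔ (a ≤ b)
    ≤⊕⇔≤ = mk⇔ (λ { (_ , h) → ⊕-upper h }) difference

    -- ⊕ is monotone in its right argument: write c = b ⊕ d and re-associate.
    ⊕-monoʳ : ∀ {a b c x y} → b ≤ c → a ⊕ b ≐ x → a ⊕ c ≐ y → x ≤ y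
    ⊕-monoʳ b≤c hx hy with difference b≤c
    ... | _ , hd with ⊕-assocˡ hd hy
    ...   | ab , hab , habd =
            subst (_≤ _) (⊕-functional hab hx) (⊕-upper habd)

    ⊕-cancelˡ : ∀ {a b y₁ y₂} → a ⊕ y₁ ≐ b → a ⊕ y₂ ≐ b → y₁ ≡ y₂
    ⊕-cancelˡ {a} {b} {y₁} {y₂} h₁ h₂ =
      ′-injective (⊕-functional (rd6 a y₁ b h₁) (rd6 a y₂ b h₂))

    -- Half of the Sasaki adjunction (RD3):  b′ ≤ a →s x′  ⇒  x ≤ a →s b.
    -- With p = a′ ⊕ (a ∧ x′) we have a′ ⊕ p′ = (a ∧ x′)′ ≥ x, and p′ ≤ a ∧ b.
    sasaki-half : ∀ a b x → b ′ ≤ (a →s (x ′)) → x ≤ (a →s b)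
    sasaki-half a b x b′≤p =
      ≤-trans x≤[a∧x′]′ (⊕-monoʳ p′≤a∧b (rd6 (a ′) _ _ (∧-def a (x ′) , ≡.refl))
                                        (∧-def a b , ≡.refl))
      where
        p′≤a : (a →s (x ′)) ′ ≤ a
        p′≤a = ′-swap (⊕-upper (∧-def a (x ′) , ≡.refl))
        p′≤a∧b : (a →s (x ′)) ′ ≤ a ∧ b
        p′≤a∧b = ∧-greatest p′≤a (′-swap b′≤p)
        x≤[a∧x′]′ : x ≤ (a ∧ x ′) ′
        x≤[a∧x′]′ = subst (_≤ (a ∧ x ′) ′) (′′ x) (′-antitone (x∧y≤y a (x ′)))

  RD1⇒RD5 : RD1 L → RD5 L
  RD1⇒RD5 (E , _ , a⊕a′) a b = mk⇔ forced (λ { ≡.refl → a⊕a′ a })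
    where
      open IsEffectAlgebra E
      forced : a ⊕ b ≐ 𝟙 → b ≡ a ′
      forced h with E3 a
      ... | _ , _ , unique = ≡.trans (≡.sym (unique h)) (unique (a⊕a′ a))

  -- From a ⊕ b = c and c ⊕ c′ = 1: (b ⊕ a) ⊕ c′ = 1, so b ⊕ (a ⊕ c′) = 1
  -- and a ⊕ c′ = b′.
  RD5⇒RD6 : RD5 L → RD6 L
  RD5⇒RD6 rd5 a b c hab with ⊕-assocʳ (⊕-comm hab) (from (rd5 c (c ′)) ≡.refl)
  ... | t , hac′ , hbt = ≐-resp ≡.refl ≡.refl (to (rd5 b t) hbt) hac′

  RD6⇒RD5 : RD6 L → RD5 L
  RD6⇒RD5 rd6 a b = mk⇔ forced (λ { ≡.refl → ≐-resp ≡.refl ≡.refl 𝟘′≡𝟙 a⊕𝟘′ })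
    where
      a⊕𝟘′ : a ⊕ (a ′) ≐ (𝟘 ′)
      a⊕𝟘′ = rd6 a 𝟘 a (⊕-unit a)
      forced : a ⊕ b ≐ 𝟙 → b ≡ a ′
      forced h = ′-shift (⊕-functional (≐-resp ≡.refl 𝟙′≡𝟘 ≡.refl (rd6 a b 𝟙 h))
                                       (⊕-unit a))

  RD5⇒RD1 : RD5 L → RD1 L
  RD5⇒RD1 rd5 = effect , lattice , (λ a → from (rd5 a (a ′)) ≡.refl)
    where
      open UnderRD6 (RD5⇒RD6 rd5)
      effect : IsEffectAlgebra
      effect = record
        { E1 = λ a b d → def-sym d , W1 a b d (def-sym d)
        ; E2 = W2
        ; E3 = λ a → a ′ , from (rd5 a (a ′)) ≡.refl , ≡.sym ∘ to (rd5 a _)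
        ; E4 = λ a → def-𝟙
        }
      -- the induced order is ≤, so ∨ and ∧ are its joins and meets
      lattice : IsLatticeOrder
      lattice =
        (λ a b → a ∨ b , from ≤⊕⇔≤ (x≤x∨y a b) , from ≤⊕⇔≤ (y≤x∨y a b) ,
                 λ z p q → from ≤⊕⇔≤ (∨-least (to ≤⊕⇔≤ p) (to ≤⊕⇔≤ q))) ,
        (λ a b → a ∧ b , from ≤⊕⇔≤ (x∧y≤x a b) , from ≤⊕⇔≤ (x∧y≤y a b) ,
                 λ z p q → from ≤⊕⇔≤ (∧-greatest (to ≤⊕⇔≤ p) (to ≤⊕⇔≤ q)))

  -- The second half of (RD3) is the first one applied to x′ and b′.
  RD6⇒RD3 : RD6 L → RD3 L
  RD6⇒RD3 rd6 a b x = mk⇔ (sasaki-half a b x) symmetric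
    where
      open UnderRD6 rd6
      symmetric : x ≤ (a →s b) → b ′ ≤ (a →s (x ′))
      symmetric h = sasaki-half a (x ′) (b ′)
        (≡.subst₂ _≤_ (≡.sym (′′ x)) (cong (a →s_) (≡.sym (′′ b))) h)

  -- (RD2) is (RD3) up to contraposition, as (a ⊗ x)′ = a →s x′.
  RD3⇒RD2 : RD3 L → RD2 L
  RD3⇒RD2 rd3 a b x = mk⇔ (to (rd3 a b x) ∘ ′-swap) (′-swap ∘ from (rd3 a b x))

  -- Instance x = 𝟙 of (RD2), using a ⊗ 𝟙 = a.
  RD2⇒RD4 : RD2 L → RD4 L
  RD2⇒RD4 rd2 a b = mk⇔
    (λ a≤b → antisym (maximum _) (to (rd2 a b 𝟙) (subst (_≤ b) (≡.sym a⊗𝟙≡a) a≤b)))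
    (λ e → subst (_≤ b) a⊗𝟙≡a (from (rd2 a b 𝟙) (subst (𝟙 ≤_) (≡.sym e) ≤-refl)))
    where
      a∧𝟙′≡𝟘 : a ∧ 𝟙 ′ ≡ 𝟘
      a∧𝟙′≡𝟘 = ≡.trans (cong (a ∧_) 𝟙′≡𝟘) (antisym (x∧y≤y a 𝟘) (minimum _))
      -- a ⊗ 1 = (a′ ⊕ 0)′ = a
      a⊗𝟙≡a : a ⊗ 𝟙 ≡ a
      a⊗𝟙≡a = ≡.trans (cong _′ (⊕-functional (∧-def a (𝟙 ′) , ≡.refl)
                        (≐-resp ≡.refl (≡.sym a∧𝟙′≡𝟘) ≡.refl (⊕-unit (a ′)))))
                      (′′ a)

  arrow-below : ∀ {a b} → b ≤ a → (a ′) ⊕ b ≐ (a →s b)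
  arrow-below {a} {b} b≤a =
    ′-antitone b≤a , plus-cong ≡.refl (≡.sym (∧-below b≤a)) (′-antitone b≤a) (∧-def a b)

  RD4⇒RD5 : RD4 L → RD5 L
  RD4⇒RD5 rd4 a b = mk⇔ forced (λ { ≡.refl → a⊕a′ })
    where
      forced : a ⊕ b ≐ 𝟙 → b ≡ a ′
      forced h@(d , _) = antisym (def-sym d) (from (rd4 (a ′) b)
        (⊕-functional (arrow-below (def-sym d)) (≐-resp (≡.sym (′′ a)) ≡.refl ≡.refl h)))
      a⊕a′ : a ⊕ (a ′) ≐ 𝟙
      a⊕a′ = ≐-resp (′′ a) ≡.refl (to (rd4 (a ′) (a ′)) ≤-refl) (arrow-below ≤-refl)

  odot-value : ∀ {a b z} (p : a ≤ b) → (a ′ ′) ⊕ (b ′) ≐ z →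
               odot (a ′) b (odot-def p) ≡ z ′
  odot-value p (_ , e) = cong _′ e

  -- (RD6) applied to a′′ ⊕ b′.
  RD6⇒RD7 : RD6 L → RD7 L
  RD6⇒RD7 rd6 a b a≤b =
    ≐-resp (′′ a) ≡.refl (′′ b) (rd6 (a ′ ′) (b ′) _ (≤-′′ (odot-def a≤b) , ≡.refl))

  RD7⇒RD5 : RD7 L → RD5 L
  RD7⇒RD5 rd7 a b =
    mk⇔ forced (λ { ≡.refl → ≐-resp ≡.refl odot≡a′ ≡.refl (rd7 a 𝟙 (maximum a)) })
    where
      -- a′ ⊙ 1 = (a ⊕ 0)′ = a′
      odot≡a′ : odot (a ′) 𝟙 (odot-def (maximum a)) ≡ a ′
      odot≡a′ = odot-value (maximum a) (≐-resp (≡.sym (′′ a)) (≡.sym 𝟙′≡𝟘) ≡.refl (⊕-unit a))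
      -- if a ⊕ b = 1 then b′ ⊙ a′ = (b ⊕ a)′ = 0, so b = b ⊕ 0 = a′
      forced : a ⊕ b ≐ 𝟙 → b ≡ a ′
      forced h@(d , _) =
        ⊕-functional (⊕-unit b) (≐-resp ≡.refl odot≡𝟘 ≡.refl (rd7 b (a ′) b≤a′))
        where
          b≤a′ : b ≤ a ′
          b≤a′ = def-sym d
          b′′⊕a′′≐𝟙 : (b ′ ′) ⊕ (a ′ ′) ≐ 𝟙
          b′′⊕a′′≐𝟙 = ≐-resp (≡.sym (′′ b)) (≡.sym (′′ a)) ≡.refl (⊕-comm h)
          odot≡𝟘 : odot (b ′) (a ′) (odot-def b≤a′) ≡ 𝟘
          odot≡𝟘 = ≡.trans (odot-value b≤a′ b′′⊕a′′≐𝟙) 𝟙′≡𝟘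

  RD6⇒RD8 : RD6 L → RD8 L
  RD6⇒RD8 rd6 a b = mk⇔ unique-difference (λ { (_ , h , _) → ⊕-upper h })
    where
      open UnderRD6 rd6
      unique-difference : a ≤ b →
                          Σ[ c ∈ Carrier ] (a ⊕ c ≐ b × (∀ {y} → a ⊕ y ≐ b → c ≡ y))
      unique-difference a≤b with difference a≤b
      ... | c , h = c , h , ⊕-cancelˡ h

  RD8⇒RD5 : RD8 L → RD5 L
  RD8⇒RD5 rd8 a b = mk⇔ (forced b) (λ { ≡.refl → a⊕a′ })
    where
      -- if a ⊕ c = 1, write a′ = c ⊕ e; then 1 ⊕ e = (a ⊕ c) ⊕ e is defined,
      -- so e = 0 and c = a′
      forced : ∀ c → a ⊕ c ≐ 𝟙 → c ≡ a ′
      forced c hc@(d , _) with to (rd8 c (a ′)) (def-sym d)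
      ... | e , hce , _ with ⊕-assocˡ hce (≤-′′ ≤-refl , ≡.refl)
      ...   | _ , hac , (s , _) =
              ⊕-functional (⊕-unit c) (≐-resp ≡.refl e≡𝟘 ≡.refl hce)
        where
          e≡𝟘 : e ≡ 𝟘
          e≡𝟘 = def-𝟙 (def-sym (subst (λ z → Def z e) (⊕-functional hac hc) s))
      a⊕a′ : a ⊕ (a ′) ≐ 𝟙
      a⊕a′ with to (rd8 a 𝟙) (maximum a)
      ... | c , h , _ = ≐-resp ≡.refl (forced c h) ≡.refl h

mainTheorem2 : (L : WeakLatticeEffectAlgebra) →
    (RD1 L ⇔ RD2 L) × (RD1 L ⇔ RD3 L) × (RD1 L ⇔ RD4 L) × (RD1 L ⇔ RD5 L) ×
    (RD1 L ⇔ RD6 L) × (RD1 L ⇔ RD7 L) × (RD1 L ⇔ RD8 L)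
mainTheorem2 L =
    sandwich RD1⇔RD6 RD1⇔RD5 (RD3⇒RD2 ∘ RD6⇒RD3) (RD4⇒RD5 ∘ RD2⇒RD4)
  , sandwich RD1⇔RD6 RD1⇔RD5 RD6⇒RD3 (RD4⇒RD5 ∘ RD2⇒RD4 ∘ RD3⇒RD2)
  , sandwich RD1⇔RD6 RD1⇔RD5 (RD2⇒RD4 ∘ RD3⇒RD2 ∘ RD6⇒RD3) RD4⇒RD5
  , RD1⇔RD5
  , RD1⇔RD6
  , sandwich RD1⇔RD6 RD1⇔RD5 RD6⇒RD7 RD7⇒RD5
  , sandwich RD1⇔RD6 RD1⇔RD5 RD6⇒RD8 RD8⇒RD5
  where
    open Conditions L
    RD1⇔RD5 : RD1 L ⇔ RD5 L
    RD1⇔RD5 = mk⇔ RD1⇒RD5 RD5⇒RD1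
    RD1⇔RD6 : RD1 L ⇔ RD6 L
    RD1⇔RD6 = sandwich RD1⇔RD5 RD1⇔RD5 RD5⇒RD6 RD6⇒RD5
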